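{- Let $A$ be a finite alphabet of cardinality $\ell$ and let $\mathbf{x}$ be an $\ell$-strict episturmian sequence over $A$. Then for all $n\ge 0$, \[ r_{\mathbf{x}}(n) = (\ell-1) \left\lfloor \frac{n+1}{2} \right\rfloor + 1. \]
   Context: A factor of a sequence is a finite contiguous block. For a finite word $u=u(1)\cdots u(m)$, its reversal is $u^R=u(m)\cdots u(1)$; $u$ and $v$ are reflectively equivalent if $v=u$ or $v=u^R$. The reflection complexity $r_{\mathbf{x}}(n)$ is the number of distinct length-$n$ factors of $\mathbf{x}$ up to reflective equivalence. A sequence is reversal-closed if for every factor $w$, $w^R$ is also a factor. A factor $u$ is left special if $au$ and $bu$ are factors for some distinct letters $a,b$. A sequence over $A$ is episturmian if it is reversal-closed and has at most one left special factor of each length. An episturmian sequence over $A$ with $|A|=\ell$ is $\ell$-strict if it has exactly one left special factor of each length and every left special factor $u$ has $\ell$ distinct left extensions $au$ ($a\in A$) that are factors. -}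

module Defs where

open import Data.Nat using (ℕ; _+_)
open import Data.Fin using (Fin; toℕ)
open import Data.Vec using (Vec; _∷_; tabulate; reverse)
open import Data.List using (List; length)
open import Data.List.Relation.Unary.All using (All)
open import Data.List.Relation.Unary.Any using (Any)
open import Data.List.Relation.Unary.AllPairs using (AllPairs)
open import Data.Product using (Σ; ∃; _×_)
open import Data.Sum using (_⊎_)
open import Relation.Binary.PropositionalEquality using (_≡_; _≢_)
open import Relation.Nullary using (¬_)

Seq : ℕ → Set
Seq ℓ = ℕ → Fin ℓ

Word : ℕ → ℕ → Set
Word ℓ n = Vec (Fin ℓ) n

block : ∀ {ℓ} → Seq ℓ → ℕ → (n : ℕ) → Word ℓ n
block x i n = tabulate (λ j → x (i + toℕ j))

Factor : ∀ {ℓ n} → Seq ℓ → Word ℓ n → Set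
Factor {n = n} x w = ∃ λ i → block x i n ≡ w

RefEq : ∀ {ℓ n} → Word ℓ n → Word ℓ n → Set
RefEq u v = (v ≡ u) ⊎ (v ≡ reverse u)

-- r_x(n) = k : there is a list of k length-n factors, pairwise reflectively
-- inequivalent, such that every length-n factor is equivalent to one of them
-- (i.e. k is the number of reflective-equivalence classes of length-n factors).
ReflComplexity : ∀ {ℓ} → Seq ℓ → ℕ → ℕ → Set
ReflComplexity {ℓ} x n k =
  Σ (List (Word ℓ n)) λ ws →
    (length ws ≡ k)
    × All (Factor x) ws
    × AllPairs (λ u v → ¬ RefEq u v) ws
    × (∀ (w : Word ℓ n) → Factor x w → Any (RefEq w) ws)

ReversalClosed : ∀ {ℓ} → Seq ℓ → Set
ReversalClosed {ℓ} x = ∀ {n} (w : Word ℓ n) → Factor x w → Factor x (reverse w)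

LeftSpecial : ∀ {ℓ n} → Seq ℓ → Word ℓ n → Set
LeftSpecial {ℓ} x u = Σ (Fin ℓ) λ a → Σ (Fin ℓ) λ b →
  (a ≢ b) × Factor x (a ∷ u) × Factor x (b ∷ u)

Episturmian : ∀ {ℓ} → Seq ℓ → Set
Episturmian {ℓ} x =
  ReversalClosed x
  × (∀ {n} (u v : Word ℓ n) → LeftSpecial x u → LeftSpecial x v → u ≡ v)

Strict : ∀ {ℓ} → Seq ℓ → Set
Strict {ℓ} x =
  Episturmian x
  × (∀ n → Σ (Word ℓ n) λ u → LeftSpecial x u)
  × (∀ {n} (u : Word ℓ n) → LeftSpecial x u → ∀ (a : Fin ℓ) → Factor x (a ∷ u))

{-# OPTIONS --safe #-}
module Submission where

-- Every factor of length n + 2 is a sandwich a u c of a factor u of length n.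
-- If u is not reflectively equivalent to the left special factor U of length n,
-- then neither u nor its reversal is left special, so u has a unique two-sided
-- extension and its class contributes exactly one class of length n + 2. The
-- class of U contributes the ℓ pairwise inequivalent classes of a U b (a ∈ A),
-- where U b is the left special factor of length n + 1. Hence
-- r(n + 2) = r(n) + ℓ - 1, starting from r(0) = 1 and r(1) = ℓ.

open import Defs
open import Data.Nat using (ℕ; zero; suc; _+_; _*_; _∸_; ⌊_/2⌋)
open import Data.Nat.Properties using (+-comm; +-suc; +-identityʳ; *-zeroʳ; *-identityʳ)
open import Data.Nat.Tactic.RingSolver using (solve-∀)
open import Data.Fin as Fin using (Fin; toℕ; _≟_)
open import Data.Vec using (Vec; []; _∷_; _∷ʳ_; reverse; init; initLast)
open import Data.Vec.Properties
  using (tabulate-cong; reverse-∷; reverse-reverse; reverse-involutive; init-∷ʳ;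
         ∷-injective; ∷-injectiveʳ; ∷ʳ-injective; ∷ʳ-injectiveˡ; ∷ʳ-injectiveʳ; ≡-dec)
open import Data.List as List using (List; []; _∷_; _++_; length)
open import Data.List.Properties using (length-++; length-tabulate)
open import Data.List.Relation.Unary.All as All using (All; []; _∷_)
import Data.List.Relation.Unary.All.Properties as All
open import Data.List.Relation.Unary.Any as Any using (Any; here; there)
import Data.List.Relation.Unary.Any.Properties as Any
open import Data.List.Relation.Unary.AllPairs using (AllPairs; []; _∷_)
import Data.List.Relation.Unary.AllPairs.Properties as AllPairs
open import Data.Product using (∃; ∃₂; _×_; _,_; proj₁; proj₂)
open import Data.Sum using (inj₁; inj₂)
open import Relation.Binary.PropositionalEquality
open import Relation.Nullary using (¬_; Dec; yes; no; contradiction)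
open import Relation.Nullary.Decidable using (decidable-stable; _⊎-dec_)

Transversal : {X : Set} → (X → Set) → (X → X → Set) → List X → Set
Transversal P _~_ ws =
  All P ws × AllPairs (λ u v → ¬ u ~ v) ws × (∀ w → P w → Any (w ~_) ws)

-- A transversal of Q up to ≋ is assembled from a transversal of P up to ≈
-- by replacing each representative v with a transversal of the fibre of π over
-- the class of v.
module Lifting
  {X Y : Set} {P : X → Set} {Q : Y → Set} {_≈_ : X → X → Set} {_≋_ : Y → Y → Set}
  (≈-sym : ∀ {u v} → u ≈ v → v ≈ u) (≈-trans : ∀ {u v w} → u ≈ v → v ≈ w → u ≈ w)
  (π : Y → X) (π-cong : ∀ {y y′} → y ≋ y′ → π y ≈ π y′) (π-P : ∀ {y} → Q y → P (π y))
  (fibre : ∀ {v} → P v → List Y)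
  (fibre-transversal : ∀ {v} (pv : P v) → Transversal (λ y → Q y × π y ≈ v) _≋_ (fibre pv))
  where

  lift : ∀ {ws} → All P ws → List Y
  lift []         = []
  lift (pv ∷ pws) = fibre pv ++ lift pws

  private
    lift-all : ∀ {ws} (pws : All P ws) → All Q (lift pws)
    lift-all []         = []
    lift-all (pv ∷ pws) =
      All.++⁺ (All.map proj₁ (proj₁ (fibre-transversal pv))) (lift-all pws)

    lift-apart : ∀ {v ws} (pws : All P ws) → All (λ v′ → ¬ v ≈ v′) ws →
                 ∀ {y} → π y ≈ v → All (λ y′ → ¬ y ≋ y′) (lift pws)
    lift-apart []          []             πy≈v = []
    lift-apart (pv′ ∷ pws) (v≉v′ ∷ apart) πy≈v =
      All.++⁺ (All.map (λ (_ , πy′≈v′) y≋y′ → v≉v′ (≈-trans (≈-sym πy≈v) (≈-trans (π-cong y≋y′) πy′≈v′)))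
                       (proj₁ (fibre-transversal pv′)))
              (lift-apart pws apart πy≈v)

    lift-pairwise : ∀ {ws} (pws : All P ws) → AllPairs (λ u v → ¬ u ≈ v) ws →
                    AllPairs (λ y y′ → ¬ y ≋ y′) (lift pws)
    lift-pairwise []         []                   = []
    lift-pairwise (pv ∷ pws) (apart ∷ pairwise) =
      AllPairs.++⁺ (proj₁ (proj₂ (fibre-transversal pv))) (lift-pairwise pws pairwise)
        (All.map (λ (_ , πy≈v) → lift-apart pws apart πy≈v) (proj₁ (fibre-transversal pv)))

    lift-covers : ∀ {ws} (pws : All P ws) {y} → Q y → Any (π y ≈_) ws → Any (y ≋_) (lift pws)
    lift-covers (pv ∷ pws) qy (here πy≈v) = Any.++⁺ˡ (proj₂ (proj₂ (fibre-transversal pv)) _ (qy , πy≈v))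
    lift-covers (pv ∷ pws) qy (there p)   = Any.++⁺ʳ (fibre pv) (lift-covers pws qy p)

  lift-transversal : ∀ {ws} (t : Transversal P _≈_ ws) → Transversal Q _≋_ (lift (proj₁ t))
  lift-transversal (pws , pairwise , covers) =
    lift-all pws , lift-pairwise pws pairwise , λ y qy → lift-covers pws qy (covers (π y) (π-P qy))

  module _ {s : X} {m : ℕ}
    (length-special  : ∀ {v} (pv : P v) → v ≈ s → length (fibre pv) ≡ suc m)
    (length-ordinary : ∀ {v} (pv : P v) → ¬ v ≈ s → length (fibre pv) ≡ 1)
    where

    private
      length-lift-apart : ∀ {ws} (pws : All P ws) → All (λ v → ¬ v ≈ s) ws → length (lift pws) ≡ length ws
      length-lift-apart []         []            = refl
      length-lift-apart {_ ∷ ws} (pv ∷ pws) (v≉s ∷ apart) = begin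
        length (fibre pv ++ lift pws)        ≡⟨ length-++ (fibre pv) ⟩
        length (fibre pv) + length (lift pws) ≡⟨ cong₂ _+_ (length-ordinary pv v≉s) (length-lift-apart pws apart) ⟩
        suc (length ws)                       ∎
        where open ≡-Reasoning

      length-lift-once : ∀ {ws} (pws : All P ws) → AllPairs (λ u v → ¬ u ≈ v) ws → Any (_≈ s) ws →
                         length (lift pws) ≡ length ws + m
      length-lift-once {v ∷ ws} (pv ∷ pws) (apart ∷ _) (here v≈s) = begin
        length (fibre pv ++ lift pws)        ≡⟨ length-++ (fibre pv) ⟩
        length (fibre pv) + length (lift pws) ≡⟨ cong₂ _+_ (length-special pv v≈s) (length-lift-apart pws others) ⟩
        suc m + length ws                     ≡⟨ cong suc (+-comm m (length ws)) ⟩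
        suc (length ws + m)                   ∎
        where
        open ≡-Reasoning
        others : All (λ v′ → ¬ v′ ≈ s) ws
        others = All.map (λ v≉v′ v′≈s → v≉v′ (≈-trans v≈s (≈-sym v′≈s))) apart
      length-lift-once {_ ∷ ws} (pv ∷ pws) (apart ∷ pairwise) (there p) = begin
        length (fibre pv ++ lift pws)        ≡⟨ length-++ (fibre pv) ⟩
        length (fibre pv) + length (lift pws) ≡⟨ cong₂ _+_ (length-ordinary pv v≉s) (length-lift-once pws pairwise p) ⟩
        suc (length ws + m)                   ∎
        where
        open ≡-Reasoning
        v≉s : ¬ _ ≈ s
        v≉s v≈s = All.All¬⇒¬Any apart (Any.map (λ v′≈s → ≈-trans v≈s (≈-sym v′≈s)) p)

    length-lift : ∀ {ws} (t : Transversal P _≈_ ws) → P s → length (lift (proj₁ t)) ≡ length ws + m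
    length-lift (pws , pairwise , covers) ps =
      length-lift-once pws pairwise (Any.map ≈-sym (covers _ ps))

module _ {A : Set} where

  sandwich : ∀ {n} → A → Vec A n → A → Vec A (2 + n)
  sandwich a v c = a ∷ (v ∷ʳ c)

  middle : ∀ {n} → Vec A (2 + n) → Vec A n
  middle (_ ∷ w) = init w

  middle-sandwich : ∀ {n} a (v : Vec A n) c → middle (sandwich a v c) ≡ v
  middle-sandwich a v c = init-∷ʳ c v

  sandwich-view : ∀ {n} (w : Vec A (2 + n)) → ∃₂ λ a v → ∃ λ c → w ≡ sandwich a v c
  sandwich-view (a ∷ w) = let v , c , w≡v∷ʳc = initLast w in a , v , c , cong (a ∷_) w≡v∷ʳc

  sandwich-injective : ∀ {n a a′ c c′} (v v′ : Vec A n) →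
                       sandwich a v c ≡ sandwich a′ v′ c′ → a ≡ a′ × v ≡ v′ × c ≡ c′
  sandwich-injective v v′ eq =
    let a≡a′ , v∷ʳc≡v′∷ʳc′ = ∷-injective eq
        v≡v′ , c≡c′ = ∷ʳ-injective v v′ v∷ʳc≡v′∷ʳc′
    in a≡a′ , v≡v′ , c≡c′

  reverse-∷ʳ : ∀ {n} (v : Vec A n) c → reverse (v ∷ʳ c) ≡ c ∷ reverse v
  reverse-∷ʳ v c = reverse-reverse (begin
    reverse (c ∷ reverse v)    ≡⟨ reverse-∷ c (reverse v) ⟩
    reverse (reverse v) ∷ʳ c   ≡⟨ cong (_∷ʳ c) (reverse-involutive v) ⟩
    v ∷ʳ c                     ∎)
    where open ≡-Reasoning

  reverse-sandwich : ∀ {n} a (v : Vec A n) c → reverse (sandwich a v c) ≡ sandwich c (reverse v) a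
  reverse-sandwich a v c = trans (reverse-∷ a (v ∷ʳ c)) (cong (_∷ʳ a) (reverse-∷ʳ v c))

  middle-reverse : ∀ {n} (w : Vec A (2 + n)) → middle (reverse w) ≡ reverse (middle w)
  middle-reverse w with sandwich-view w
  ... | a , v , c , refl = begin
    middle (reverse (sandwich a v c))     ≡⟨ cong middle (reverse-sandwich a v c) ⟩
    middle (sandwich c (reverse v) a)     ≡⟨ middle-sandwich c (reverse v) a ⟩
    reverse v                             ≡⟨ cong reverse (middle-sandwich a v c) ⟨
    reverse (middle (sandwich a v c))     ∎
    where open ≡-Reasoning

module _ {ℓ n : ℕ} where

  RefEq-sym : {u v : Word ℓ n} → RefEq u v → RefEq v u
  RefEq-sym     (inj₁ refl) = inj₁ refl
  RefEq-sym {u} (inj₂ refl) = inj₂ (sym (reverse-involutive u))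

  RefEq-trans : {u v w : Word ℓ n} → RefEq u v → RefEq v w → RefEq u w
  RefEq-trans     (inj₁ refl) v~w         = v~w
  RefEq-trans     (inj₂ refl) (inj₁ refl) = inj₂ refl
  RefEq-trans {u} (inj₂ refl) (inj₂ refl) = inj₁ (reverse-involutive u)

  RefEq-dec : (u v : Word ℓ n) → Dec (RefEq u v)
  RefEq-dec u v = ≡-dec _≟_ v u ⊎-dec ≡-dec _≟_ v (reverse u)

  middle-cong : {y y′ : Word ℓ (2 + n)} → RefEq y y′ → RefEq (middle y) (middle y′)
  middle-cong     (inj₁ refl) = inj₁ refl
  middle-cong {y} (inj₂ refl) = inj₂ (middle-reverse y)

  sandwich-apart : ∀ {a a′ c} {v : Word ℓ n} → a ≢ a′ → ¬ RefEq (sandwich a v c) (sandwich a′ v c)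
  sandwich-apart {v = v} a≢a′ (inj₁ eq) = a≢a′ (sym (proj₁ (sandwich-injective v v eq)))
  sandwich-apart {a} {c = c} {v} a≢a′ (inj₂ eq) =
    let a′≡c , _ , c≡a = sandwich-injective v (reverse v) (trans eq (reverse-sandwich a v c))
    in a≢a′ (sym (trans a′≡c c≡a))

module _ {ℓ : ℕ} (x : Seq ℓ) where

  block-∷ : ∀ i n → block x i (suc n) ≡ x i ∷ block x (suc i) n
  block-∷ i n = cong₂ _∷_ (cong x (+-identityʳ i)) (tabulate-cong (λ j → cong x (+-suc i (toℕ j))))

  block-∷ʳ : ∀ i n → block x i (suc n) ≡ block x i n ∷ʳ x (i + n)
  block-∷ʳ i zero    = refl
  block-∷ʳ i (suc n) = begin
    block x i (2 + n)                          ≡⟨ block-∷ i (suc n) ⟩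
    x i ∷ block x (suc i) (suc n)              ≡⟨ cong (x i ∷_) (block-∷ʳ (suc i) n) ⟩
    x i ∷ (block x (suc i) n ∷ʳ x (suc i + n)) ≡⟨ cong (λ j → x i ∷ (block x (suc i) n ∷ʳ x j)) (+-suc i n) ⟨
    (x i ∷ block x (suc i) n) ∷ʳ x (i + suc n) ≡⟨ cong (_∷ʳ x (i + suc n)) (block-∷ i n) ⟨
    block x i (suc n) ∷ʳ x (i + suc n)         ∎
    where open ≡-Reasoning

  Factor-tail : ∀ {n a} {v : Word ℓ n} → Factor x (a ∷ v) → Factor x v
  Factor-tail {n} (i , eq) = suc i , ∷-injectiveʳ (trans (sym (block-∷ i n)) eq)

  Factor-init : ∀ {n c} {v : Word ℓ n} → Factor x (v ∷ʳ c) → Factor x v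
  Factor-init {n} {v = v} (i , eq) = i , ∷ʳ-injectiveˡ (block x i n) v (trans (sym (block-∷ʳ i n)) eq)

  Factor-middle : ∀ {n} {w : Word ℓ (2 + n)} → Factor x w → Factor x (middle w)
  Factor-middle {w = w} f with sandwich-view w
  ... | a , v , c , refl = subst (Factor x) (sym (middle-sandwich a v c)) (Factor-init (Factor-tail f))

  Factor-extendʳ : ∀ {n} {v : Word ℓ n} → Factor x v → ∃ λ c → Factor x (v ∷ʳ c)
  Factor-extendʳ {n} (i , refl) = x (i + n) , i , block-∷ʳ i n

  LeftSpecial-init : ∀ {n c} {u : Word ℓ n} → LeftSpecial x (u ∷ʳ c) → LeftSpecial x u
  LeftSpecial-init (a , b , a≢b , fa , fb) = a , b , a≢b , Factor-init fa , Factor-init fb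

  unique-left-extension : ∀ {n a a′} {v : Word ℓ n} → ¬ LeftSpecial x v →
                          Factor x (a ∷ v) → Factor x (a′ ∷ v) → a ≡ a′
  unique-left-extension {a = a} {a′} ¬special fa fa′ =
    decidable-stable (a ≟ a′) (λ a≢a′ → ¬special (a , a′ , a≢a′ , fa , fa′))

reflComplexity-0 : ∀ {ℓ} (x : Seq ℓ) → ReflComplexity x 0 1
reflComplexity-0 x = [] ∷ [] , refl , (0 , refl) ∷ [] , [] ∷ [] , λ { [] _ → here (inj₁ refl) }

module ReversalClosedSequence {ℓ : ℕ} {x : Seq ℓ} (closed : ReversalClosed x) where

  Factor-extendˡ : ∀ {n} {v : Word ℓ n} → Factor x v → ∃ λ a → Factor x (a ∷ v)
  Factor-extendˡ {v = v} f =
    let a , fa = Factor-extendʳ x (closed v f)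
    in a , subst (Factor x) (trans (reverse-∷ʳ (reverse v) a) (cong (a ∷_) (reverse-involutive v))) (closed _ fa)

  Factor-extend : ∀ {n} {v : Word ℓ n} → Factor x v → ∃₂ λ a c → Factor x (sandwich a v c)
  Factor-extend f = let a , fa = Factor-extendˡ f in a , Factor-extendʳ x fa

  LeftSpecial-reverse : ∀ {n c c′} {v : Word ℓ n} → c ≢ c′ →
                        Factor x (v ∷ʳ c) → Factor x (v ∷ʳ c′) → LeftSpecial x (reverse v)
  LeftSpecial-reverse {c = c} {c′} {v} c≢c′ fc fc′ =
    c , c′ , c≢c′ , subst (Factor x) (reverse-∷ʳ v c) (closed _ fc) , subst (Factor x) (reverse-∷ʳ v c′) (closed _ fc′)

  unique-right-extension : ∀ {n c c′} {v : Word ℓ n} → ¬ LeftSpecial x (reverse v) →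
                           Factor x (v ∷ʳ c) → Factor x (v ∷ʳ c′) → c ≡ c′
  unique-right-extension {c = c} {c′} ¬special fc fc′ =
    decidable-stable (c ≟ c′) (λ c≢c′ → ¬special (LeftSpecial-reverse c≢c′ fc fc′))

  unique-two-sided-extension : ∀ {n a a′ c c′} {v : Word ℓ n} →
    ¬ LeftSpecial x v → ¬ LeftSpecial x (reverse v) →
    Factor x (sandwich a v c) → Factor x (sandwich a′ v c′) → sandwich a v c ≡ sandwich a′ v c′
  unique-two-sided-extension {v = v} ¬special ¬special-reverse f f′ =
    cong₂ (λ a c → sandwich a v c)
      (unique-left-extension x ¬special (Factor-init x f) (Factor-init x f′))
      (unique-right-extension ¬special-reverse (Factor-tail x f) (Factor-tail x f′))

  -- A factor whose middle is the reversal of v is reflectively equivalent to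
  -- one whose middle is v itself.
  covers-by-reflection : ∀ {n} {v : Word ℓ n} (ys : List (Word ℓ (2 + n))) →
    (∀ a c → Factor x (sandwich a v c) → Any (RefEq (sandwich a v c)) ys) →
    ∀ y → Factor x y × RefEq (middle y) v → Any (RefEq y) ys
  covers-by-reflection {v = v} ys covers y (fy , middle≈v) with sandwich-view y
  ... | a , w , c , refl with subst (λ u → RefEq u v) (middle-sandwich a w c) middle≈v
  ... | inj₁ refl = covers a c fy
  ... | inj₂ refl =
    Any.map (RefEq-trans (inj₂ (sym (reverse-sandwich a w c))))
      (covers c a (subst (Factor x) (reverse-sandwich a w c) (closed _ fy)))

module StrictEpisturmian {m : ℕ} {x : Seq (suc m)} (strict : Strict x) where

  private
    W : ℕ → Set
    W = Word (suc m)

    closed : ReversalClosed x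
    closed = proj₁ (proj₁ strict)

  open ReversalClosedSequence {x = x} closed

  special : ∀ n → W n
  special n = proj₁ (proj₁ (proj₂ strict) n)

  special-leftSpecial : ∀ n → LeftSpecial x (special n)
  special-leftSpecial n = proj₂ (proj₁ (proj₂ strict) n)

  ≡special : ∀ {n} {u : W n} → LeftSpecial x u → u ≡ special n
  ≡special {n} {u} ls = proj₂ (proj₁ strict) u (special n) ls (special-leftSpecial n)

  special-extendˡ : ∀ {n} a → Factor x (a ∷ special n)
  special-extendˡ {n} = proj₂ (proj₂ strict) (special n) (special-leftSpecial n)

  special-suc : ∀ n → ∃ λ b → special (suc n) ≡ special n ∷ʳ b
  special-suc n =
    let u , b , eq = initLast (special (suc n))
        u≡special = ≡special (LeftSpecial-init x (subst (LeftSpecial x) eq (special-leftSpecial (suc n))))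
    in b , trans eq (cong (_∷ʳ b) u≡special)

  next : ℕ → Fin (suc m)
  next n = proj₁ (special-suc n)

  special-sandwich : ∀ n a → Factor x (sandwich a (special n) (next n))
  special-sandwich n a = subst (λ w → Factor x (a ∷ w)) (proj₂ (special-suc n)) (special-extendˡ a)

  -- If c ≠ next n, both special n and a ∷ special n are right special; their
  -- reversals are then left special, which forces special n to be a palindrome
  -- and a = next n.
  special-two-sided : ∀ {n a c} → Factor x (sandwich a (special n) c) →
    ∃ λ a′ → RefEq (sandwich a (special n) c) (sandwich a′ (special n) (next n))
  special-two-sided {n} {a} {c} f with c ≟ next n
  ... | yes refl = a , inj₁ refl
  ... | no c≢b = c , inj₂ (begin
    sandwich c U b             ≡⟨ cong₂ (sandwich c) (sym palindrome) (sym a≡b) ⟩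
    sandwich c (reverse U) a   ≡⟨ reverse-sandwich a U c ⟨
    reverse (sandwich a U c)   ∎)
    where
    open ≡-Reasoning
    U = special n
    b = next n
    palindrome : reverse U ≡ U
    palindrome = ≡special (LeftSpecial-reverse c≢b (Factor-tail x f) (Factor-tail x (special-sandwich n a)))
    a≡b : a ≡ b
    a≡b = sym (∷ʳ-injectiveʳ U U (begin
      U ∷ʳ b               ≡⟨ proj₂ (special-suc n) ⟨
      special (suc n)      ≡⟨ ≡special (LeftSpecial-reverse {v = a ∷ U} c≢b f (special-sandwich n a)) ⟨
      reverse (a ∷ U)      ≡⟨ reverse-∷ a U ⟩
      reverse U ∷ʳ a       ≡⟨ cong (_∷ʳ a) palindrome ⟩
      U ∷ʳ a               ∎))

  ordinary-two-sided : ∀ {n a a′ c c′} {v : W n} → ¬ RefEq v (special n) →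
    Factor x (sandwich a v c) → Factor x (sandwich a′ v c′) → sandwich a v c ≡ sandwich a′ v c′
  ordinary-two-sided v≉special = unique-two-sided-extension
    (λ ls → v≉special (inj₁ (sym (≡special ls))))
    (λ ls → v≉special (inj₂ (sym (≡special ls))))

  module _ (n : ℕ) where

    specialExtension : Fin (suc m) → W (2 + n)
    specialExtension a = sandwich a (special n) (next n)

    specialFibre : List (W (2 + n))
    specialFibre = List.tabulate specialExtension

    ordinaryFibre : {v : W n} → Factor x v → List (W (2 + n))
    ordinaryFibre {v} fv = let a , c , _ = Factor-extend fv in sandwich a v c ∷ []

    fibre : {v : W n} → Factor x v → List (W (2 + n))
    fibre {v} fv with RefEq-dec v (special n)
    ... | yes _ = specialFibre
    ... | no  _ = ordinaryFibre fv

    Fibre : W n → W (2 + n) → Set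
    Fibre v y = Factor x y × RefEq (middle y) v

    specialFibre-transversal : {v : W n} → RefEq v (special n) → Transversal (Fibre v) RefEq specialFibre
    specialFibre-transversal {v} v≈special =
        All.tabulate⁺ {f = specialExtension} (λ a → special-sandwich n a , over-v a)
      , AllPairs.tabulate⁺ {f = specialExtension} sandwich-apart
      , λ y (fy , middle≈v) → covers-by-reflection specialFibre covers y (fy , RefEq-trans middle≈v v≈special)
      where
      over-v : ∀ a → RefEq (middle (sandwich a (special n) (next n))) v
      over-v a = subst (λ u → RefEq u v) (sym (middle-sandwich a (special n) (next n))) (RefEq-sym v≈special)
      covers : ∀ a c → Factor x (sandwich a (special n) c) → Any (RefEq (sandwich a (special n) c)) specialFibre
      covers a c f = let a′ , eq = special-two-sided f in Any.tabulate⁺ {f = specialExtension} a′ eq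

    ordinaryFibre-transversal : {v : W n} (fv : Factor x v) → ¬ RefEq v (special n) →
                                Transversal (Fibre v) RefEq (ordinaryFibre fv)
    ordinaryFibre-transversal {v} fv v≉special =
      let a , c , f = Factor-extend fv in
        (f , inj₁ (sym (middle-sandwich a v c))) ∷ []
      , [] ∷ []
      , covers-by-reflection _ (λ a′ c′ f′ → here (inj₁ (ordinary-two-sided v≉special f f′)))

    fibre-transversal : {v : W n} (fv : Factor x v) → Transversal (Fibre v) RefEq (fibre fv)
    fibre-transversal {v} fv with RefEq-dec v (special n)
    ... | yes v≈special = specialFibre-transversal v≈special
    ... | no  v≉special = ordinaryFibre-transversal fv v≉special

    length-fibre-special : {v : W n} (fv : Factor x v) → RefEq v (special n) → length (fibre fv) ≡ suc m
    length-fibre-special {v} fv v≈special with RefEq-dec v (special n)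
    ... | yes _         = length-tabulate specialExtension
    ... | no  v≉special = contradiction v≈special v≉special

    length-fibre-ordinary : {v : W n} (fv : Factor x v) → ¬ RefEq v (special n) → length (fibre fv) ≡ 1
    length-fibre-ordinary {v} fv v≉special with RefEq-dec v (special n)
    ... | yes v≈special = contradiction v≈special v≉special
    ... | no  _         = refl

  reflComplexity-+2 : ∀ {n k} → ReflComplexity x n k → ReflComplexity x (2 + n) (k + m)
  reflComplexity-+2 {n} (ws , refl , t) =
    lift (proj₁ t) , length-lift (length-fibre-special n) (length-fibre-ordinary n) t special-factor , lift-transversal t
    where
    open Lifting {_≈_ = RefEq} {_≋_ = RefEq} RefEq-sym RefEq-trans middle middle-cong (Factor-middle x) (fibre n) (fibre-transversal n)
    special-factor : Factor x (special n)
    special-factor = Factor-tail x (special-extendˡ {n} Fin.zero)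

  reflComplexity-1 : ReflComplexity x 1 (suc m)
  reflComplexity-1 =
      List.tabulate letterWord
    , length-tabulate letterWord
    , All.tabulate⁺ {f = letterWord} letter
    , AllPairs.tabulate⁺ {f = letterWord} (λ a≢a′ → λ { (inj₁ refl) → a≢a′ refl ; (inj₂ refl) → a≢a′ refl })
    , λ { (a ∷ []) _ → Any.tabulate⁺ {f = letterWord} a (inj₁ refl) }
    where
    letterWord : Fin (suc m) → W 1
    letterWord a = a ∷ []
    letter : ∀ a → Factor x (a ∷ [])
    letter a with special 0 | special-extendˡ {0} a
    ... | [] | f = f

theorem6p5 : (ℓ : ℕ) (x : Seq ℓ) → Strict x →
    ∀ (n : ℕ) → ReflComplexity x n ((ℓ ∸ 1) * ⌊ n + 1 /2⌋ + 1)
theorem6p5 zero x _ _ with x 0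
... | ()
theorem6p5 (suc m) x strict zero =
  subst (ReflComplexity x 0) (cong (_+ 1) (sym (*-zeroʳ m))) (reflComplexity-0 x)
theorem6p5 (suc m) x strict (suc zero) =
  subst (ReflComplexity x 1) (sym (trans (cong (_+ 1) (*-identityʳ m)) (+-comm m 1))) reflComplexity-1
  where open StrictEpisturmian {x = x} strict
theorem6p5 (suc m) x strict (suc (suc n)) =
  subst (ReflComplexity x (2 + n)) (count m ⌊ n + 1 /2⌋) (reflComplexity-+2 (theorem6p5 (suc m) x strict n))
  where
  open StrictEpisturmian {x = x} strict
  count : ∀ k q → k * q + 1 + k ≡ k * suc q + 1
  count = solve-∀
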